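{- Let $H$ be the disjoint union $\bigcup_i K_{n_i}$ of complete graphs with each $n_i\ge 1$. Then for every connected graph $G$, ${\rm gp}(G\odot H) = \omega((G\odot H)_{\rm SR})$.
   Context: All graphs are finite and simple. For a connected graph $X$, a set $S\subseteq V(X)$ is a general position set if no three pairwise distinct vertices of $S$ lie on a common geodesic of $X$; ${\rm gp}(X)$ is the maximum cardinality of a general position set. A vertex $u$ is maximally distant from $v$ if every neighbor $w$ of $u$ satisfies $d_X(v,w)\le d_X(u,v)$; $u,v$ are mutually maximally distant (MMD) if each is maximally distant from the other. The strong resolving graph $X_{\rm SR}$ has vertex set $V(X)$, two vertices adjacent iff they are MMD in $X$. $\omega$ is the clique number. For graphs $G$ with $V(G)=\{v_1,\dots,v_n\}$ and $H$, the corona $G\odot H$ is obtained from the disjoint union of $G$ and $n$ disjoint copies $H_1,\dots,H_n$ of $H$ by joining $v_i$ to every vertex of $H_i$ for all $i$. -}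

module Defs where

open import Data.Nat using (ℕ; zero; suc; _+_; _*_; _≤_)
open import Data.Fin using (Fin; splitAt; remQuot)
open import Data.Fin.Subset using (Subset; _∈_; ∣_∣)
open import Data.Product using (Σ; ∃; _×_; _,_)
open import Data.Sum using (_⊎_; inj₁; inj₂)
import Data.Sum
open import Data.Empty using (⊥)
open import Relation.Nullary using (¬_)
open import Relation.Binary.PropositionalEquality using (_≡_; _≢_)
open import Function.Definitions using (Surjective)

record Graph (n : ℕ) : Set₁ where
  field
    Adj     : Fin n → Fin n → Set
    sym     : ∀ {u v} → Adj u v → Adj v u
    irrefl  : ∀ {u} → ¬ Adj u u
open Graph public

module _ {n : ℕ} (X : Graph n) where

  data Walk : Fin n → Fin n → ℕ → Set where
    here : ∀ {u} → Walk u u 0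
    step : ∀ {u w v k} → Adj X u w → Walk w v k → Walk u v (suc k)

  Connected : Set
  Connected = ∀ u v → ∃ λ k → Walk u v k

  Dist : Fin n → Fin n → ℕ → Set
  Dist u v k = Walk u v k × (∀ m → Walk u v m → k ≤ m)

  OnGeodesic : Fin n → Fin n → Fin n → Set
  OnGeodesic u w v = ∃ λ a → ∃ λ b → Dist u w a × Dist w v b × Dist u v (a + b)

  GenPos : Subset n → Set
  GenPos S = ∀ u v w → u ∈ S → v ∈ S → w ∈ S →
             u ≢ v → v ≢ w → u ≢ w → ¬ OnGeodesic u w v

  IsGp : ℕ → Set
  IsGp k = (∃ λ S → GenPos S × ∣ S ∣ ≡ k) × (∀ S → GenPos S → ∣ S ∣ ≤ k)

  MaxDistant : Fin n → Fin n → Set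
  MaxDistant u v = ∀ w → Adj X u w → ∀ a b → Dist v w a → Dist u v b → a ≤ b

  MMD : Fin n → Fin n → Set
  MMD u v = MaxDistant u v × MaxDistant v u

  SR : Graph n
  SR = record
    { Adj    = λ u v → u ≢ v × MMD u v
    ; sym    = λ { (u≢v , p , q) → (λ e → u≢v (symm e)) , q , p }
    ; irrefl = λ { (u≢u , _) → u≢u _≡_.refl }
    }
    where
      symm : ∀ {a b : Fin n} → a ≡ b → b ≡ a
      symm _≡_.refl = _≡_.refl

  Clique : Subset n → Set
  Clique S = ∀ u v → u ∈ S → v ∈ S → u ≢ v → Adj X u v

  IsCliqueNumber : ℕ → Set
  IsCliqueNumber k = (∃ λ S → Clique S × ∣ S ∣ ≡ k) × (∀ S → Clique S → ∣ S ∣ ≤ k)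

-- Disjoint union of complete graphs: vertex x of H lies in the clique c x;
-- two distinct vertices are adjacent iff they lie in the same clique.
CliqueUnion : (m k : ℕ) → (Fin m → Fin k) → Graph m
CliqueUnion m k c = record
  { Adj    = λ u v → u ≢ v × c u ≡ c v
  ; sym    = λ { (u≢v , e) → (λ e' → u≢v (sy e')) , sy e }
  ; irrefl = λ { (u≢u , _) → u≢u _≡_.refl }
  }
  where
    sy : ∀ {A : Set} {a b : A} → a ≡ b → b ≡ a
    sy _≡_.refl = _≡_.refl

-- Corona G ⊙ H. Vertices of G ⊙ H are Fin (n + n * m):
-- the first n are the vertices of G, the vertex n + (i * m + h) is vertex h of copy H_i.
CVertex : ℕ → ℕ → Set
CVertex n m = Fin n ⊎ (Fin n × Fin m)

view : ∀ {n m} → Fin (n + n * m) → CVertex n m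
view {n} {m} x = Data.Sum.map₂ (remQuot {n} m) (splitAt n x)

CAdj : ∀ {n m} → Graph n → Graph m → CVertex n m → CVertex n m → Set
CAdj G H (inj₁ i) (inj₁ j) = Adj G i j
CAdj G H (inj₁ i) (inj₂ (j , h)) = i ≡ j
CAdj G H (inj₂ (i , h)) (inj₁ j) = i ≡ j
CAdj G H (inj₂ (i , h)) (inj₂ (j , h')) = i ≡ j × Adj H h h'

private
  sy : ∀ {A : Set} {a b : A} → a ≡ b → b ≡ a
  sy _≡_.refl = _≡_.refl

CAdj-sym : ∀ {n m} (G : Graph n) (H : Graph m) {u v} → CAdj G H u v → CAdj G H v u
CAdj-sym G H {inj₁ i} {inj₁ j} a = sym G a
CAdj-sym G H {inj₁ i} {inj₂ _} e = sy e
CAdj-sym G H {inj₂ _} {inj₁ j} e = sy e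
CAdj-sym G H {inj₂ _} {inj₂ _} (e , a) = sy e , sym H a

CAdj-irrefl : ∀ {n m} (G : Graph n) (H : Graph m) {u} → ¬ CAdj G H u u
CAdj-irrefl G H {inj₁ i} a = irrefl G a
CAdj-irrefl G H {inj₂ _} (_ , a) = irrefl H a

corona : ∀ {n m} → Graph n → Graph m → Graph (n + n * m)
corona G H = record
  { Adj    = λ x y → CAdj G H (view x) (view y)
  ; sym    = λ {x} {y} → CAdj-sym G H {view x} {view y}
  ; irrefl = λ {x} → CAdj-irrefl G H {view x}
  }

-- The proof rests on simplicial vertices (vertices whose neighbourhood is a
-- clique).  A simplicial vertex is maximally distant from every other vertex
-- and is never an inner vertex of a geodesic; hence any set of simplicial
-- vertices is simultaneously in general position and a clique of the strong
-- resolving graph.  If such a set S also bounds both kinds of sets from above,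
-- then gp = ω(X_SR) = |S|.
--
-- In G ⊙ H, with H a union of cliques, every leaf (vertex of a copy H_i) is
-- simplicial, and there are n·m of them.  Unless G ⊙ H is complete, n·m is an
-- upper bound:
--   * a general-position set containing a base vertex i together with a leaf
--     of H_i lies inside {i} ∪ H_i and misses a vertex there (or n ≥ 2);
--     otherwise it meets each fibre {i} ∪ H_i in at most m vertices;
--   * a base vertex is mutually maximally distant from no other vertex, so an
--     SR-clique is a single base vertex or consists of leaves only.
-- Counting is done fibrewise: |S| is the sum over i of |S ∩ ({i} ∪ H_i)|.
-- When G ⊙ H is complete (G = K₁, H = K_m) every vertex is simplicial.
module Submission where

open import Defs
open import Data.Nat using (ℕ; zero; suc; _+_; _*_; _≤_; _<_; z≤n; s≤s)
open import Data.Nat.Properties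
  using (≤-trans; ≤-reflexive; n≤1+n; 1+n≰n; ≮⇒≥; m≤m+n; +-comm; +-assoc;
         +-mono-≤; +-monoˡ-≤; +-monoʳ-≤; *-identityʳ; +-0-commutativeMonoid; module ≤-Reasoning)
open import Data.Nat.Induction using (<-rec)
open import Data.Bool using (Bool; true; false)
open import Data.Fin using (Fin; zero; suc; _↑ˡ_; _↑ʳ_; combine; splitAt; join; punchIn)
open import Data.Fin.Properties
  using (_≟_; any?; splitAt-↑ˡ; splitAt-↑ʳ; join-splitAt; remQuot-combine; combine-remQuot; punchInᵢ≢i)
open import Data.Fin.Subset using (Subset; _∈_; _∉_; _⊆_; ⊤; ⁅_⁆; ∣_∣)
open import Data.Fin.Subset.Properties using (_∈?_; ∣⊤∣≡n; ∣p∣≤n; p⊆q⇒∣p∣≤∣q∣; ∣⁅x⁆∣≡1; x∈⁅x⁆)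
open import Data.Vec using (_∷_; []; lookup; tabulate)
open import Data.Vec.Properties using (lookup∘tabulate; []=⇒lookup; lookup⇒[]=)
open import Data.Vec.Functional using (removeAt)
open import Data.Product using (∃; _×_; _,_; proj₁; proj₂)
open import Data.Sum using (_⊎_; inj₁; inj₂)
open import Data.Empty using (⊥; ⊥-elim)
open import Function using (_∘_)
open import Function.Definitions using (Surjective)
open import Relation.Nullary using (¬_; yes; no)
open import Relation.Nullary.Decidable using (_×-dec_)
open import Relation.Binary.PropositionalEquality as ≡
  using (_≡_; _≢_; refl; cong; cong₂; subst; subst₂; ≢-sym; module ≡-Reasoning)
open import Algebra.Properties.CommutativeMonoid.Sum +-0-commutativeMonoid
  using (sum; sum-syntax; sum-cong-≗; sum-replicate-zero; sum-remove; ∑-distrib-+)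

-- Walks and distances in an arbitrary graph.

module Walks {N : ℕ} (X : Graph N) where

  _▷_ : ∀ {u v w k} → Walk X u v k → Adj X v w → Walk X u w (suc k)
  here       ▷ e′ = step e′ here
  step e p   ▷ e′ = step e (p ▷ e′)

  reverse : ∀ {u v k} → Walk X u v k → Walk X v u k
  reverse here       = here
  reverse (step e p) = reverse p ▷ sym X e

  _++ʷ_ : ∀ {u v w k l} → Walk X u v k → Walk X v w l → Walk X u w (k + l)
  here     ++ʷ q = q
  step e p ++ʷ q = step e (p ++ʷ q)

  walk-0 : ∀ {u v} → Walk X u v 0 → u ≡ v
  walk-0 here = refl

  dist-sym : ∀ {u v k} → Dist X u v k → Dist X v u k
  dist-sym (p , shortest) = reverse p , λ j q → shortest j (reverse q)

  dist-adj : ∀ {u v} → Adj X u v → Dist X u v 1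
  dist-adj {u} {v} e = step e here , shortest
    where
    shortest : ∀ j → Walk X u v j → 1 ≤ j
    shortest zero    p = ⊥-elim (irrefl X (subst (Adj X u) (≡.sym (walk-0 p)) e))
    shortest (suc j) _ = s≤s z≤n

  dist-two : ∀ {u w v} → u ≢ v → ¬ Adj X u v → Adj X u w → Adj X w v → Dist X u v 2
  dist-two {u} {w} {v} u≢v ¬uv uw wv = step uw (step wv here) , shortest
    where
    shortest : ∀ j → Walk X u v j → 2 ≤ j
    shortest zero          p           = ⊥-elim (u≢v (walk-0 p))
    shortest (suc zero)    (step e p)  = ⊥-elim (¬uv (subst (Adj X u) (walk-0 p) e))
    shortest (suc (suc j)) _           = s≤s (s≤s z≤n)

  -- Two vertices joined by a walk have a distance (classically): if they had
  -- none, strong induction on the length would show that no walk exists.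
  dist-exists : ∀ {u v k} → Walk X u v k → ¬ ¬ ∃ (Dist X u v)
  dist-exists {u} {v} {k} p noDist = <-rec (λ j → ¬ Walk X u v j) noWalk k p
    where
    noWalk : ∀ j → (∀ {i} → i < j → ¬ Walk X u v i) → ¬ Walk X u v j
    noWalk j shorter q = noDist (j , q , λ i r → ≮⇒≥ (λ i<j → shorter i<j r))

-- Simplicial vertices.

module SimplicialVertices {N : ℕ} (X : Graph N) where
  open Walks X

  Simplicial : Fin N → Set
  Simplicial u = ∀ {a b} → Adj X u a → Adj X u b → a ≢ b → Adj X a b

  -- Leaving a simplicial vertex u never gets closer to v: the first step of a
  -- shortest u,v-walk is w itself or adjacent to w.
  simplicial-maxDistant : ∀ {u v} → Simplicial u → u ≢ v → MaxDistant X u v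
  simplicial-maxDistant {u} {v} simp u≢v w uw a _ (_ , shortest) (p , _) = via p
    where
    via : ∀ {b} → Walk X u v b → a ≤ b
    via here = ⊥-elim (u≢v refl)
    via (step {w = u′} uu′ rest) with u′ ≟ w
    ... | yes refl = ≤-trans (shortest _ (reverse rest)) (n≤1+n _)
    ... | no u′≢w  = shortest _ (reverse rest ▷ simp uu′ uw u′≢w)

  -- A simplicial vertex w is not an inner vertex of a geodesic: the two
  -- neighbours of w on it coincide or are adjacent, giving a shortcut.
  simplicial-not-inner : ∀ {u w v} → Simplicial w → u ≢ w → w ≢ v → ¬ OnGeodesic X u w v
  simplicial-not-inner {u} {w} {v} simp u≢w w≢v (_ , _ , (p , _) , (q , _) , (_ , shortest)) =
    shortcut (reverse p) q shortest
    where
    shortcut : ∀ {a b} → Walk X w u a → Walk X w v b → (∀ j → Walk X u v j → a + b ≤ j) → ⊥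
    shortcut here       _          _ = u≢w refl
    shortcut (step _ _) here       _ = w≢v refl
    shortcut {suc a} {suc b} (step {w = p′} wp r) (step {w = q′} wq s) geodesic with p′ ≟ q′
    ... | yes refl = 1+n≰n (≤-trans (geodesic _ (reverse r ++ʷ s)) (+-monoʳ-≤ a (n≤1+n b)))
    ... | no p′≢q′ = 1+n≰n (geodesic _ (reverse r ++ʷ step (simp wp wq p′≢q′) s))

  gp≡ω-by-simplicial : ∀ (S : Subset N) g → ∣ S ∣ ≡ g → (∀ {x} → x ∈ S → Simplicial x) →
                       (∀ T → GenPos X T → ∣ T ∣ ≤ g) → (∀ T → Clique (SR X) T → ∣ T ∣ ≤ g) →
                       IsGp X g × IsCliqueNumber (SR X) g
  gp≡ω-by-simplicial S g ∣S∣≡g simp gp-bound sr-bound =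
    ((S , genPos , ∣S∣≡g) , gp-bound) , ((S , srClique , ∣S∣≡g) , sr-bound)
    where
    genPos : GenPos X S
    genPos _ _ _ _ _ w∈S _ v≢w u≢w = simplicial-not-inner (simp w∈S) u≢w (≢-sym v≢w)

    srClique : Clique (SR X) S
    srClique _ _ u∈S v∈S u≢v =
      u≢v , simplicial-maxDistant (simp u∈S) u≢v , simplicial-maxDistant (simp v∈S) (≢-sym u≢v)

  gp≡ω-all-simplicial : (∀ x → Simplicial x) → IsGp X N × IsCliqueNumber (SR X) N
  gp≡ω-all-simplicial simp =
    gp≡ω-by-simplicial ⊤ N (∣⊤∣≡n N) (λ {x} _ → simp x) (λ T _ → ∣p∣≤n T) (λ T _ → ∣p∣≤n T)

-- Finite sums of natural numbers.

sum-≤ : ∀ {n c} (f : Fin n → ℕ) → (∀ i → f i ≤ c) → sum f ≤ n * c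
sum-≤ {zero}  f _  = z≤n
sum-≤ {suc n} f le = +-mono-≤ (le zero) (sum-≤ (f ∘ suc) (le ∘ suc))

sum-const : ∀ n c → ∑[ i < n ] c ≡ n * c
sum-const zero    c = refl
sum-const (suc n) c = cong (c +_) (sum-const n c)

sum-zero : ∀ {n} (f : Fin n → ℕ) → (∀ i → f i ≡ 0) → sum f ≡ 0
sum-zero {n} f vanish = ≡.trans (sum-cong-≗ vanish) (sum-replicate-zero n)

sum-concentrated : ∀ {n} (f : Fin n → ℕ) i → (∀ j → j ≢ i → f j ≡ 0) → sum f ≡ f i
sum-concentrated {suc n} f i vanish = begin
  sum f                      ≡⟨ sum-remove f ⟩
  f i + sum (removeAt f i)   ≡⟨ cong (f i +_) (sum-zero _ (λ j → vanish _ (punchInᵢ≢i i j))) ⟩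
  f i + 0                    ≡⟨ +-comm (f i) 0 ⟩
  f i                        ∎
  where open ≡-Reasoning

sum-01-missing : ∀ {m} (f : Fin m → ℕ) h → (∀ j → f j ≤ 1) → f h ≡ 0 → suc (sum f) ≤ m
sum-01-missing {suc m} f h le fh≡0 = s≤s (begin
  sum f                      ≡⟨ sum-remove f ⟩
  f h + sum (removeAt f h)   ≡⟨ cong (_+ sum (removeAt f h)) fh≡0 ⟩
  sum (removeAt f h)         ≤⟨ sum-≤ (removeAt f h) (le ∘ punchIn h) ⟩
  m * 1                      ≡⟨ *-identityʳ m ⟩
  m                          ∎)
  where open ≤-Reasoning

sum-↑ : ∀ a b (f : Fin (a + b) → ℕ) → sum f ≡ ∑[ i < a ] f (i ↑ˡ b) + ∑[ j < b ] f (a ↑ʳ j)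
sum-↑ zero    b f = refl
sum-↑ (suc a) b f = ≡.trans (cong (f zero +_) (sum-↑ a b (f ∘ suc))) (≡.sym (+-assoc (f zero) _ _))

sum-combine : ∀ n m (f : Fin (n * m) → ℕ) → sum f ≡ ∑[ i < n ] ∑[ h < m ] f (combine i h)
sum-combine zero    m f = refl
sum-combine (suc n) m f =
  ≡.trans (sum-↑ m (n * m) f)
          (cong (∑[ h < m ] f (h ↑ˡ (n * m)) +_) (sum-combine n m (λ (j : Fin (n * m)) → f (m ↑ʳ j))))

-- Counting subsets: |S| is the sum of the membership indicators.

𝟙 : Bool → ℕ
𝟙 true  = 1
𝟙 false = 0

𝟙≤1 : ∀ b → 𝟙 b ≤ 1
𝟙≤1 true  = s≤s z≤n
𝟙≤1 false = z≤n

[_∈_] : ∀ {N} → Fin N → Subset N → ℕ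
[ x ∈ S ] = 𝟙 (lookup S x)

∉⇒[∈]≡0 : ∀ {N} {x : Fin N} {S} → x ∉ S → [ x ∈ S ] ≡ 0
∉⇒[∈]≡0 {x = x} {S} x∉S with lookup S x in eq
... | true  = ⊥-elim (x∉S (lookup⇒[]= x S eq))
... | false = refl

∣∣≡sum : ∀ {N} (S : Subset N) → ∣ S ∣ ≡ ∑[ x < N ] [ x ∈ S ]
∣∣≡sum []          = refl
∣∣≡sum (true ∷ S)  = cong suc (∣∣≡sum S)
∣∣≡sum (false ∷ S) = ∣∣≡sum S

1≤ : ∀ {m} → Fin m → 1 ≤ m
1≤ {suc m} _ = s≤s z≤n

≤-*ˡ : ∀ {n} m → Fin n → m ≤ n * m
≤-*ˡ {suc n} m _ = m≤m+n m (n * m)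

suc≤* : ∀ {n m} {i j : Fin n} → j ≢ i → Fin m → suc m ≤ n * m
suc≤* {suc zero}    {i = zero} {zero} j≢i _ = ⊥-elim (j≢i refl)
suc≤* {suc (suc n)} {m}        _      h   = begin
  1 + m              ≤⟨ +-monoˡ-≤ m (1≤ h) ⟩
  m + m              ≤⟨ +-monoʳ-≤ m (m≤m+n m (n * m)) ⟩
  m + (m + n * m)    ∎
  where open ≤-Reasoning

-- The corona G ⊙ H of arbitrary graphs G and H.

module Corona {n m : ℕ} (G : Graph n) (H : Graph m) where

  C : Graph (n + n * m)
  C = corona G H

  open Walks C
  open SimplicialVertices C

  ⌞_⌟ : CVertex n m → Fin (n + n * m)
  ⌞ inj₁ i       ⌟ = i ↑ˡ (n * m)
  ⌞ inj₂ (i , h) ⌟ = n ↑ʳ combine i h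

  base : Fin n → Fin (n + n * m)
  base i = ⌞ inj₁ i ⌟

  leaf : Fin n → Fin m → Fin (n + n * m)
  leaf i h = ⌞ inj₂ (i , h) ⌟

  view-⌞⌟ : ∀ a → view ⌞ a ⌟ ≡ a
  view-⌞⌟ (inj₁ i)       rewrite splitAt-↑ˡ n i (n * m) = refl
  view-⌞⌟ (inj₂ (i , h)) rewrite splitAt-↑ʳ n (n * m) (combine i h) | remQuot-combine i h = refl

  ⌞⌟-view : ∀ x → ⌞ view x ⌟ ≡ x
  ⌞⌟-view x with splitAt n x in eq
  ... | inj₁ i = ≡.trans (cong (join n (n * m)) (≡.sym eq)) (join-splitAt n (n * m) x)
  ... | inj₂ j = ≡.trans (cong (n ↑ʳ_) (combine-remQuot {n} m j))
                         (≡.trans (cong (join n (n * m)) (≡.sym eq)) (join-splitAt n (n * m) x))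

  ⌞⌟-injective : ∀ {a b} → ⌞ a ⌟ ≡ ⌞ b ⌟ → a ≡ b
  ⌞⌟-injective {a} {b} e = ≡.trans (≡.sym (view-⌞⌟ a)) (≡.trans (cong view e) (view-⌞⌟ b))

  base≢leaf : ∀ {i j h} → base i ≢ leaf j h
  base≢leaf {i} {j} {h} e with ⌞⌟-injective {inj₁ i} {inj₂ (j , h)} e
  ... | ()

  base-injective : ∀ {i j} → base i ≡ base j → i ≡ j
  base-injective {i} {j} e with ⌞⌟-injective {inj₁ i} {inj₁ j} e
  ... | refl = refl

  leaf-injective : ∀ {i h h′} → leaf i h ≡ leaf i h′ → h ≡ h′
  leaf-injective {i} {h} {h′} e with ⌞⌟-injective {inj₂ (i , h)} {inj₂ (i , h′)} e
  ... | refl = refl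

  leaf-fibre : ∀ {i j h h′} → leaf j h ≡ leaf i h′ → j ≡ i
  leaf-fibre {i} {j} {h} {h′} e with ⌞⌟-injective {inj₂ (j , h)} {inj₂ (i , h′)} e
  ... | refl = refl

  data Kind : Fin (n + n * m) → Set where
    base-kind : ∀ i   → Kind (base i)
    leaf-kind : ∀ i h → Kind (leaf i h)

  kind : ∀ x → Kind x
  kind x = subst Kind (⌞⌟-view x) (kind-of (view x))
    where
    kind-of : ∀ a → Kind ⌞ a ⌟
    kind-of (inj₁ i)       = base-kind i
    kind-of (inj₂ (i , h)) = leaf-kind i h

  adj⁺ : ∀ {a b} → CAdj G H a b → Adj C ⌞ a ⌟ ⌞ b ⌟
  adj⁺ {a} {b} = subst₂ (CAdj G H) (≡.sym (view-⌞⌟ a)) (≡.sym (view-⌞⌟ b))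

  adj⁻ : ∀ {a b} → Adj C ⌞ a ⌟ ⌞ b ⌟ → CAdj G H a b
  adj⁻ {a} {b} = subst₂ (CAdj G H) (view-⌞⌟ a) (view-⌞⌟ b)

  spoke : ∀ {i h} → Adj C (base i) (leaf i h)
  spoke {i} {h} = adj⁺ {inj₁ i} {inj₂ (i , h)} refl

  base-adj : ∀ {i j} → Adj G i j → Adj C (base i) (base j)
  base-adj {i} {j} = adj⁺ {inj₁ i} {inj₁ j}

  leaf-base-adj⁻ : ∀ {i h j} → Adj C (leaf i h) (base j) → i ≡ j
  leaf-base-adj⁻ {i} {h} {j} = adj⁻ {inj₂ (i , h)} {inj₁ j}

  leaf-leaf-adj⁻ : ∀ {i h j h′} → Adj C (leaf i h) (leaf j h′) → i ≡ j × Adj H h h′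
  leaf-leaf-adj⁻ {i} {h} {j} {h′} = adj⁻ {inj₂ (i , h)} {inj₂ (j , h′)}

  view-injective : ∀ {x y} → view x ≡ view y → x ≡ y
  view-injective {x} {y} e = ≡.trans (≡.sym (⌞⌟-view x)) (≡.trans (cong ⌞_⌟ e) (⌞⌟-view y))

  simplicial-⌞⌟ : ∀ a → (∀ {b c} → CAdj G H a b → CAdj G H a c → b ≢ c → CAdj G H b c) →
                  Simplicial ⌞ a ⌟
  simplicial-⌞⌟ a simp {x} {y} ax ay x≢y =
    subst₂ (Adj C) (⌞⌟-view x) (⌞⌟-view y)
      (adj⁺ {view x} {view y}
            (simp (subst (λ z → CAdj G H z (view x)) (view-⌞⌟ a) ax)
                  (subst (λ z → CAdj G H z (view y)) (view-⌞⌟ a) ay)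
                  (x≢y ∘ view-injective)))

  -- A leaf is simplicial as soon as its vertex is simplicial in H: its
  -- neighbours are its base and its H-neighbours in the same copy.
  leaf-simplicial : ∀ i {h} → SimplicialVertices.Simplicial H h → Simplicial (leaf i h)
  leaf-simplicial i {h} simpH = simplicial-⌞⌟ (inj₂ (i , h)) neighbours-adjacent
    where
    neighbours-adjacent : ∀ {b c} → CAdj G H (inj₂ (i , h)) b → CAdj G H (inj₂ (i , h)) c →
                          b ≢ c → CAdj G H b c
    neighbours-adjacent {inj₁ _} {inj₁ _} refl refl b≢c = ⊥-elim (b≢c refl)
    neighbours-adjacent {inj₁ _} {inj₂ _} refl (refl , _) _ = refl
    neighbours-adjacent {inj₂ _} {inj₁ _} (refl , _) refl _ = refl
    neighbours-adjacent {inj₂ _} {inj₂ _} (refl , hh₁) (refl , hh₂) b≢c =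
      refl , simpH hh₁ hh₂ (λ { refl → b≢c refl })

  base-simplicial : ∀ {i} → (∀ j → ¬ Adj G i j) → (∀ {h h′} → h ≢ h′ → Adj H h h′) →
                    Simplicial (base i)
  base-simplicial {i} isolated complete = simplicial-⌞⌟ (inj₁ i) neighbours-adjacent
    where
    neighbours-adjacent : ∀ {b c} → CAdj G H (inj₁ i) b → CAdj G H (inj₁ i) c →
                          b ≢ c → CAdj G H b c
    neighbours-adjacent {inj₁ j} e _ _ = ⊥-elim (isolated j e)
    neighbours-adjacent {inj₂ _} {inj₁ j} _ e _ = ⊥-elim (isolated j e)
    neighbours-adjacent {inj₂ _} {inj₂ _} refl refl b≢c = refl , complete (λ { refl → b≢c refl })

  NotLeafOf : Fin n → Fin (n + n * m) → Set
  NotLeafOf i x = ∀ h → x ≢ leaf i h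

  leaf-of? : ∀ i x → (∃ λ h → x ≡ leaf i h) ⊎ NotLeafOf i x
  leaf-of? i x with kind x
  ... | base-kind j   = inj₂ (λ _ → base≢leaf)
  ... | leaf-kind j h with j ≟ i
  ...   | yes refl = inj₁ (h , refl)
  ...   | no j≢i   = inj₂ (λ _ e → j≢i (leaf-fibre e))

  leaf-exit : ∀ {x i h} → Adj C x (leaf i h) → NotLeafOf i x → x ≡ base i
  leaf-exit {x} {i} {h} e notLeaf with kind x
  ... | base-kind j    = cong base (≡.sym (leaf-base-adj⁻ (sym C e)))
  ... | leaf-kind j h′ with leaf-leaf-adj⁻ (sym C e)
  ...   | refl , _ = ⊥-elim (notLeaf h′ refl)

  enter : ∀ {x y L} i → Walk C x y L → (∃ λ h → y ≡ leaf i h) → NotLeafOf i x →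
          ∃ λ L′ → Walk C x (base i) L′ × L′ < L
  enter i here (h , refl) notLeaf = ⊥-elim (notLeaf h refl)
  enter i (step {w = x₁} e rest) atLeaf notLeaf with leaf-of? i x₁
  ... | inj₁ (h , refl) = 0 , subst (λ z → Walk C _ z 0) (leaf-exit e notLeaf) here , s≤s z≤n
  ... | inj₂ notLeaf₁ with enter i rest atLeaf notLeaf₁
  ...   | L′ , w , L′<L = suc L′ , step e w , s≤s L′<L

  through-base : ∀ {x i h a} → NotLeafOf i x → Dist C x (base i) a → Dist C x (leaf i h) (suc a)
  through-base {x} {i} {h} {a} notLeaf (w , shortest) = w ▷ spoke , longer
    where
    longer : ∀ L → Walk C x (leaf i h) L → suc a ≤ L
    longer L p with enter i p (h , refl) notLeaf
    ... | L′ , w′ , L′<L = ≤-trans (s≤s (shortest L′ w′)) L′<L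

  lift-walk : ∀ {i j L} → Walk G i j L → Walk C (base i) (base j) L
  lift-walk here       = here
  lift-walk (step e p) = step (base-adj e) (lift-walk p)

  dist-to-base : Connected G → ∀ x i → ¬ ¬ ∃ (Dist C x (base i))
  dist-to-base conn x i with kind x
  ... | base-kind j   = dist-exists (lift-walk (proj₂ (conn j i)))
  ... | leaf-kind j h = dist-exists (step (sym C spoke) (lift-walk (proj₂ (conn j i))))

  -- Non-degeneracy: G has at least two vertices, or every vertex of H has a
  -- non-neighbour.  For connected G this says that G ⊙ H is not complete.
  Nontrivial : Set
  Nontrivial = (∀ (i : Fin n) → ∃ λ j → j ≢ i) ⊎ (∀ h → ∃ λ h′ → h′ ≢ h × ¬ Adj H h h′)

  -- In that case every base vertex i has, for each leaf of H_i, a neighbour at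
  -- distance 2 from that leaf: a G-neighbour of i, or a non-adjacent leaf of H_i.
  far-neighbour : Connected G → Nontrivial → ∀ i h → ∃ λ w → Adj C (base i) w × Dist C (leaf i h) w 2
  far-neighbour conn (inj₁ other) i h with other i
  ... | j , j≢i = first-step (proj₂ (conn i j)) j≢i
    where
    first-step : ∀ {j L} → Walk G i j L → j ≢ i → ∃ λ w → Adj C (base i) w × Dist C (leaf i h) w 2
    first-step here j≢i = ⊥-elim (j≢i refl)
    first-step (step {w = i′} e _) _ =
      base i′ , base-adj e ,
      dist-two (≢-sym base≢leaf) (λ e′ → irrefl G (subst (Adj G i) (≡.sym (leaf-base-adj⁻ e′)) e))
               (sym C spoke) (base-adj e)
  far-neighbour conn (inj₂ nonNeighbour) i h with nonNeighbour h
  ... | h′ , h′≢h , ¬hh′ =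
    leaf i h′ , spoke ,
    dist-two (h′≢h ∘ ≡.sym ∘ leaf-injective) (¬hh′ ∘ proj₂ ∘ leaf-leaf-adj⁻)
             (sym C spoke) spoke

  InFibre : Fin n → Fin (n + n * m) → Set
  InFibre i x = x ≡ base i ⊎ ∃ λ h → x ≡ leaf i h

  -- A general-position set containing base i and a leaf of H_i lies in the
  -- fibre of i: any other vertex x would see base i on an x,leaf-geodesic.
  genPos-confined : Connected G → ∀ {S i h x} → GenPos C S → base i ∈ S → leaf i h ∈ S →
                    x ∈ S → InFibre i x
  genPos-confined conn {S} {i} {h} {x} gp b∈S l∈S x∈S with x ≟ base i | leaf-of? i x
  ... | yes x≡b | _              = inj₁ x≡b
  ... | no _    | inj₁ atLeaf    = inj₂ atLeaf
  ... | no x≢b  | inj₂ notLeaf   = ⊥-elim (dist-to-base conn x i λ { (a , d) →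
        gp x (leaf i h) (base i) x∈S l∈S b∈S (notLeaf h) (≢-sym base≢leaf) x≢b
          (a , 1 , d , dist-adj spoke , subst (Dist C x (leaf i h)) (+-comm 1 a) (through-base notLeaf d)) })

  -- Such a set contains no leaf of H_i non-adjacent (in H) to the given one,
  -- since base i lies between two non-adjacent leaves of H_i.
  genPos-leaf-excluded : ∀ {S i h h′} → GenPos C S → base i ∈ S → leaf i h ∈ S →
                         h′ ≢ h → ¬ Adj H h h′ → leaf i h′ ∉ S
  genPos-leaf-excluded {S} {i} {h} {h′} gp b∈S l∈S h′≢h ¬hh′ l′∈S =
    gp (leaf i h) (leaf i h′) (base i) l∈S l′∈S b∈S l≢l′ (≢-sym base≢leaf) (≢-sym base≢leaf)
      (1 , 1 , dist-adj (sym C spoke) , dist-adj spoke ,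
       dist-two l≢l′ (¬hh′ ∘ proj₂ ∘ leaf-leaf-adj⁻) (sym C spoke) spoke)
    where
    l≢l′ : leaf i h ≢ leaf i h′
    l≢l′ = h′≢h ∘ ≡.sym ∘ leaf-injective

  -- Unless G ⊙ H is complete, base i is maximally distant from no other vertex:
  -- a leaf of H_i is farther from a vertex outside H_i, and a far neighbour is
  -- farther from a leaf of H_i.
  base-not-maxDistant : Connected G → Nontrivial → Fin m → ∀ {i x} → x ≢ base i →
                        ¬ MaxDistant C (base i) x
  base-not-maxDistant conn nt h₀ {i} {x} x≢b maxDist with leaf-of? i x
  ... | inj₂ notLeaf = dist-to-base conn x i λ { (a , d) →
        1+n≰n (maxDist (leaf i h₀) spoke (suc a) a (through-base notLeaf d) (dist-sym d)) }
  ... | inj₁ (h , refl) with far-neighbour conn nt i h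
  ...   | w , e , d₂ = 1+n≰n (maxDist w e 2 1 d₂ (dist-adj spoke))

  srClique-base-alone : Connected G → Nontrivial → Fin m → ∀ {S i} → Clique (SR C) S →
                        base i ∈ S → S ⊆ ⁅ base i ⁆
  srClique-base-alone conn nt h₀ {S} {i} clique b∈S {x} x∈S with x ≟ base i
  ... | yes refl = x∈⁅x⁆ x
  ... | no x≢b   = ⊥-elim (base-not-maxDistant conn nt h₀ x≢b
                             (proj₁ (proj₂ (clique (base i) x b∈S x∈S (≢-sym x≢b)))))

  fibreCount : Subset (n + n * m) → Fin n → ℕ
  fibreCount S i = [ base i ∈ S ] + ∑[ h < m ] [ leaf i h ∈ S ]

  ∣∣≡sum-fibres : ∀ S → ∣ S ∣ ≡ ∑[ i < n ] fibreCount S i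
  ∣∣≡sum-fibres S = begin
    ∣ S ∣                                             ≡⟨ ∣∣≡sum S ⟩
    ∑[ x < n + n * m ] [ x ∈ S ]                      ≡⟨ sum-↑ n (n * m) (λ x → [ x ∈ S ]) ⟩
    ∑[ i < n ] inBase i + ∑[ j < n * m ] inCopies j   ≡⟨ cong (∑[ i < n ] inBase i +_) (sum-combine n m inCopies) ⟩
    ∑[ i < n ] inBase i + ∑[ i < n ] inCopy i         ≡⟨ ∑-distrib-+ inBase inCopy ⟨
    ∑[ i < n ] fibreCount S i                         ∎
    where
    open ≡-Reasoning
    inBase : Fin n → ℕ
    inBase i = [ base i ∈ S ]
    inCopies : Fin (n * m) → ℕ
    inCopies j = [ n ↑ʳ j ∈ S ]
    inCopy : Fin n → ℕ
    inCopy i = ∑[ h < m ] [ leaf i h ∈ S ]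

  fibre-≤-base∉ : ∀ {S i} → base i ∉ S → fibreCount S i ≤ m
  fibre-≤-base∉ {S} {i} b∉S = begin
    [ base i ∈ S ] + inCopy   ≡⟨ cong (_+ inCopy) (∉⇒[∈]≡0 b∉S) ⟩
    inCopy                    ≤⟨ sum-≤ (λ h → [ leaf i h ∈ S ]) (λ h → 𝟙≤1 _) ⟩
    m * 1                     ≡⟨ *-identityʳ m ⟩
    m                         ∎
    where
    open ≤-Reasoning
    inCopy : ℕ
    inCopy = ∑[ h < m ] [ leaf i h ∈ S ]

  fibre-≤-leaf∉ : ∀ {S i h} → leaf i h ∉ S → fibreCount S i ≤ m
  fibre-≤-leaf∉ {S} {i} {h} l∉S =
    ≤-trans (+-monoˡ-≤ (∑[ h < m ] [ leaf i h ∈ S ]) (𝟙≤1 _))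
            (sum-01-missing (λ h → [ leaf i h ∈ S ]) h (λ _ → 𝟙≤1 _) (∉⇒[∈]≡0 l∉S))

  fibre-≤ : ∀ S i → fibreCount S i ≤ suc m
  fibre-≤ S i = +-mono-≤ (𝟙≤1 _) (≤-trans (sum-≤ (λ h → [ leaf i h ∈ S ]) (λ h → 𝟙≤1 _))
                                            (≤-reflexive (*-identityʳ m)))

  fibres-bounded : ∀ S → (∀ i → fibreCount S i ≤ m) → ∣ S ∣ ≤ n * m
  fibres-bounded S small = ≤-trans (≤-reflexive (∣∣≡sum-fibres S)) (sum-≤ _ small)

  fibre-concentrated : ∀ S i → (∀ {x} → x ∈ S → InFibre i x) → ∣ S ∣ ≡ fibreCount S i
  fibre-concentrated S i inside = ≡.trans (∣∣≡sum-fibres S) (sum-concentrated _ i empty)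
    where
    outside : ∀ {j x} → j ≢ i → InFibre j x → x ∉ S
    outside j≢i (inj₁ refl)       b∈S with inside b∈S
    ... | inj₁ e       = j≢i (base-injective e)
    ... | inj₂ (_ , e) = base≢leaf e
    outside j≢i (inj₂ (_ , refl)) l∈S with inside l∈S
    ... | inj₁ e       = base≢leaf (≡.sym e)
    ... | inj₂ (_ , e) = j≢i (leaf-fibre e)

    empty : ∀ j → j ≢ i → fibreCount S j ≡ 0
    empty j j≢i = cong₂ _+_ (∉⇒[∈]≡0 (outside j≢i (inj₁ refl)))
                            (sum-zero _ (λ h → ∉⇒[∈]≡0 (outside j≢i (inj₂ (h , refl)))))

  -- If some fibre contains base i and
  -- a leaf of H_i, then S lies in that fibre and either G has a second vertex
  -- (fibre size 1 + m ≤ n·m) or S misses a leaf there.  Otherwise each fibre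
  -- misses base i or a fixed leaf h₀.
  genPos-bound : Connected G → Nontrivial → Fin m → ∀ S → GenPos C S → ∣ S ∣ ≤ n * m
  genPos-bound conn nt h₀ S gp with any? (λ i → base i ∈? S ×-dec any? (λ h → leaf i h ∈? S))
  ... | yes (i , b∈S , h , l∈S) = begin
    ∣ S ∣            ≡⟨ fibre-concentrated S i (genPos-confined conn gp b∈S l∈S) ⟩
    fibreCount S i   ≤⟨ fibre-small nt ⟩
    n * m            ∎
    where
    open ≤-Reasoning
    fibre-small : Nontrivial → fibreCount S i ≤ n * m
    fibre-small (inj₁ other) = ≤-trans (fibre-≤ S i) (suc≤* (proj₂ (other i)) h₀)
    fibre-small (inj₂ nonNeighbour) with nonNeighbour h
    ... | h′ , h′≢h , ¬hh′ =
      ≤-trans (fibre-≤-leaf∉ (genPos-leaf-excluded gp b∈S l∈S h′≢h ¬hh′)) (≤-*ˡ m i)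
  ... | no noneMixed = fibres-bounded S fibre-small
    where
    fibre-small : ∀ i → fibreCount S i ≤ m
    fibre-small i with base i ∈? S
    ... | yes b∈S = fibre-≤-leaf∉ (λ l∈S → noneMixed (i , b∈S , h₀ , l∈S))
    ... | no b∉S  = fibre-≤-base∉ b∉S

  -- Upper bound for X_SR-cliques: a single base vertex, or leaves only.
  srClique-bound : Connected G → Nontrivial → Fin m → ∀ S → Clique (SR C) S → ∣ S ∣ ≤ n * m
  srClique-bound conn nt h₀ S clique with any? (λ i → base i ∈? S)
  ... | yes (i , b∈S) = begin
    ∣ S ∣            ≤⟨ p⊆q⇒∣p∣≤∣q∣ (srClique-base-alone conn nt h₀ clique b∈S) ⟩
    ∣ ⁅ base i ⁆ ∣   ≡⟨ ∣⁅x⁆∣≡1 (base i) ⟩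
    1                ≤⟨ ≤-trans (1≤ h₀) (≤-*ˡ m i) ⟩
    n * m            ∎
    where open ≤-Reasoning
  ... | no noBase = fibres-bounded S (λ i → fibre-≤-base∉ (λ b∈S → noBase (i , b∈S)))

  isLeaf : CVertex n m → Bool
  isLeaf (inj₁ _) = false
  isLeaf (inj₂ _) = true

  leaves : Subset (n + n * m)
  leaves = tabulate (isLeaf ∘ view)

  lookup-leaves : ∀ a → lookup leaves ⌞ a ⌟ ≡ isLeaf a
  lookup-leaves a = ≡.trans (lookup∘tabulate (isLeaf ∘ view) ⌞ a ⌟) (cong isLeaf (view-⌞⌟ a))

  ∈leaves : ∀ {x} → x ∈ leaves → ∃ λ i → ∃ λ h → x ≡ leaf i h
  ∈leaves {x} x∈L with kind x
  ... | leaf-kind i h = i , h , refl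
  ... | base-kind i with ≡.trans (≡.sym (lookup-leaves (inj₁ i))) ([]=⇒lookup x∈L)
  ...   | ()

  ∣leaves∣ : ∣ leaves ∣ ≡ n * m
  ∣leaves∣ = begin
    ∣ leaves ∣                       ≡⟨ ∣∣≡sum-fibres leaves ⟩
    ∑[ i < n ] fibreCount leaves i   ≡⟨ sum-cong-≗ fibre-full ⟩
    ∑[ i < n ] m                     ≡⟨ sum-const n m ⟩
    n * m                            ∎
    where
    open ≡-Reasoning
    fibre-full : ∀ i → fibreCount leaves i ≡ m
    fibre-full i = cong₂ _+_ (cong 𝟙 (lookup-leaves (inj₁ i)))
      (≡.trans (sum-cong-≗ (λ h → cong 𝟙 (lookup-leaves (inj₂ (i , h)))))
               (≡.trans (sum-const m 1) (*-identityʳ m)))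

  gp≡ω-leaves : Connected G → Nontrivial → Fin m → (∀ h → SimplicialVertices.Simplicial H h) →
                IsGp C (n * m) × IsCliqueNumber (SR C) (n * m)
  gp≡ω-leaves conn nt h₀ clusters =
    gp≡ω-by-simplicial leaves (n * m) ∣leaves∣ leaf∈leaves-simplicial
      (genPos-bound conn nt h₀) (srClique-bound conn nt h₀)
    where
    leaf∈leaves-simplicial : ∀ {x} → x ∈ leaves → Simplicial x
    leaf∈leaves-simplicial x∈L with ∈leaves x∈L
    ... | i , h , refl = leaf-simplicial i (clusters h)

  -- Degenerate case: for G without edges and H complete, G ⊙ H is a disjoint
  -- union of complete graphs, so all its vertices are simplicial.
  gp≡ω-complete : (∀ i j → ¬ Adj G i j) → (∀ {h h′} → h ≢ h′ → Adj H h h′) →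
                  IsGp C (n + n * m) × IsCliqueNumber (SR C) (n + n * m)
  gp≡ω-complete edgeless complete = gp≡ω-all-simplicial all-simplicial
    where
    all-simplicial : ∀ x → Simplicial x
    all-simplicial x with kind x
    ... | base-kind i   = base-simplicial (edgeless i) complete
    ... | leaf-kind i h = leaf-simplicial i (λ _ _ h₁≢h₂ → complete h₁≢h₂)

-- Unions of cliques and the theorem.

cliqueUnion-simplicial : ∀ {m k} (c : Fin m → Fin k) h →
                         SimplicialVertices.Simplicial (CliqueUnion m k c) h
cliqueUnion-simplicial c h (_ , ch≡ca) (_ , ch≡cb) a≢b = a≢b , ≡.trans (≡.sym ch≡ca) ch≡cb

single-clique-complete : ∀ {m} (c : Fin m → Fin 1) {h h′} → h ≢ h′ → Adj (CliqueUnion m 1 c) h h′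
single-clique-complete c {h} {h′} h≢h′ = h≢h′ , same (c h) (c h′)
  where
  same : ∀ (a b : Fin 1) → a ≡ b
  same zero zero = refl

another : ∀ {a} (x : Fin (suc (suc a))) → ∃ λ y → y ≢ x
another zero    = suc zero , λ ()
another (suc _) = zero , λ ()

cliqueUnion-nonNeighbour : ∀ {m k} (c : Fin m → Fin (suc (suc k))) → Surjective _≡_ _≡_ c →
                           ∀ h → ∃ λ h′ → h′ ≢ h × ¬ Adj (CliqueUnion m (suc (suc k)) c) h h′
cliqueUnion-nonNeighbour c surj h with another (c h)
... | b , b≢ch with surj b
...   | h′ , ch′≡b = h′ , (λ { refl → b≢ch (≡.sym (ch′≡b refl)) })
                        , (λ { (_ , ch≡ch′) → b≢ch (≡.sym (≡.trans ch≡ch′ (ch′≡b refl))) })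

-- The corona of G with a union of k+1 cliques is non-degenerate, unless G is a
-- single vertex (so edgeless) and there is only one clique (so H is complete).
corona-dichotomy : ∀ {m k} (c : Fin m → Fin (suc k)) → Surjective _≡_ _≡_ c → ∀ {n} (G : Graph n) →
                   Corona.Nontrivial G (CliqueUnion m (suc k) c)
                   ⊎ ((∀ i j → ¬ Adj G i j) × (∀ {h h′} → h ≢ h′ → Adj (CliqueUnion m (suc k) c) h h′))
corona-dichotomy             c surj {zero}          G = inj₁ (inj₁ λ ())
corona-dichotomy             c surj {suc (suc n)}   G = inj₁ (inj₁ another)
corona-dichotomy {k = suc k} c surj {suc zero}      G = inj₁ (inj₂ (cliqueUnion-nonNeighbour c surj))
corona-dichotomy {k = zero}  c surj {suc zero}      G =
  inj₂ ((λ { zero zero → irrefl G }) , single-clique-complete c)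

proposition3p2 : (m k : ℕ) (c : Fin m → Fin (suc k)) → Surjective _≡_ _≡_ c →
                 (n : ℕ) (G : Graph n) → Connected G →
                 ∃ λ g → IsGp (corona G (CliqueUnion m (suc k) c)) g
                       × IsCliqueNumber (SR (corona G (CliqueUnion m (suc k) c))) g
-- H is nonempty, as some vertex lies in clique 0.
proposition3p2 m k c surj n G conn with corona-dichotomy c surj G
... | inj₁ nontrivial =
  n * m , gp≡ω-leaves conn nontrivial (proj₁ (surj zero)) (cliqueUnion-simplicial c)
  where open Corona G (CliqueUnion m (suc k) c)
... | inj₂ (edgeless , complete) =
  n + n * m , gp≡ω-complete edgeless complete
  where open Corona G (CliqueUnion m (suc k) c)
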